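{- Let $G=(V,E^+,E^-)$ be a signed graph and let $\mathcal F$ be its flow clutter. Then $\mathcal F$ is ideal if and only if $\mathcal F$ has no weakly MNI strong minor.
   Context: A signed graph $G=(V,E^+,E^-)$ is a (multi)graph $G=(V,E)$ whose edge set $E=E^+\cup E^-$ is partitioned into positive edges $E^+$ and negative edges $E^-$. A circuit is a cycle without repeated vertices (viewed as its edge set). A flow of $G$ is a circuit containing exactly one negative edge. The flow clutter $\mathcal F=\mathcal F(G)$ is the family of edge sets of flows of $G$, with ground set $E$. A clutter $\mathcal C$ on a finite ground set $E(\mathcal C)$ is a family of subsets none of which contains another. Its covering polyhedron is $\mathsf P_{A(\mathcal C)}=\{x\in\mathbb R^{E(\mathcal C)}: x\ge 0,\ \sum_{e\in C}x_e\ge 1\ \forall C\in\mathcal C\}$; $\mathcal C$ is ideal if this polyhedron is integral (all vertices are integral), and non-ideal otherwise. For $e\in E(\mathcal C)$, the contraction $\mathcal C/e$ is the clutter on $E(\mathcal C)\setminus\{e\}$ of inclusion-minimal sets among $\{C\setminus\{e\}: C\in\mathcal C\}$, and the deletion $\mathcal C\setminus e=\{C\in\mathcal C: e\notin C\}$ on $E(\mathcal C)\setminus\{e\}$. A minor is obtained by a sequence of contractions and deletions. A strong minor of a flow clutter $\mathcal F(G)$ is a minor obtained by a sequence of contractions of positive edges and deletions of arbitrary edges, such that no member of size one (a singleton) arises; equivalently it is the flow clutter of a strong minor of $G$, i.e. a signed graph obtained from $G$ by contracting positive edges and deleting arbitrary edges without creating self-loops. A flow clutter is weakly MNI if it is not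 ideal but every proper strong minor of it is ideal.
   Formalization: Points of the covering polyhedron $\mathsf P_{A(\mathcal C)}$, including its vertices, have rational coordinates rather than real ones. -}

module Defs where

open import Data.Nat as ℕ using (ℕ; zero; suc)
open import Data.Nat.Properties as ℕP using ()
open import Data.Fin using (Fin; zero; suc; toℕ; fromℕ<; punchIn; _≟_)
open import Data.Fin.Subset using (Subset; _∈_)
open import Data.Fin.Subset.Properties using (_∈?_)
open import Data.Bool using (Bool; true; false; if_then_else_)
open import Data.Product using (Σ; ∃; ∃-syntax; _×_; _,_; proj₁; proj₂)
open import Data.Sum using (_⊎_)
open import Data.Vec using (tabulate)
open import Data.Integer using (ℤ)
open import Data.Rational using (ℚ; 0ℚ; 1ℚ; _+_; _*_; _-_; _≤_; _<_; _/_)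
open import Function using (_∘_; Injective)
open import Relation.Nullary using (¬_; does)
open import Relation.Nullary.Decidable using (⌊_⌋)
open import Relation.Binary.PropositionalEquality using (_≡_)
open import Data.Fin.Properties using (any?)

-- Signed (multi)graphs on vertex set Fin n with edge set Fin m.
-- Each edge has two ends (equal ends = self-loop) and a sign
-- (negative e ≡ true means e ∈ E⁻).

record SignedGraph (n m : ℕ) : Set where
  field
    ends     : Fin m → Fin n × Fin n
    negative : Fin m → Bool
open SignedGraph public

Joins : ∀ {n m} → SignedGraph n m → Fin m → Fin n → Fin n → Set
Joins G e x y =
  (proj₁ (ends G e) ≡ x × proj₂ (ends G e) ≡ y) ⊎
  (proj₁ (ends G e) ≡ y × proj₂ (ends G e) ≡ x)

IsLoop : ∀ {n m} → SignedGraph n m → Fin m → Set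
IsLoop G e = proj₁ (ends G e) ≡ proj₂ (ends G e)

next : ∀ {k} → Fin (suc k) → Fin (suc k)
next {k} i with suc (toℕ i) ℕ.<? suc k
... | Relation.Nullary.yes p = fromℕ< p
... | Relation.Nullary.no _  = zero

record Circuit {n m} (G : SignedGraph n m) : Set where
  field
    len   : ℕ
    verts : Fin (suc len) → Fin n
    edges : Fin (suc len) → Fin m
    verts-inj : Injective _≡_ _≡_ verts
    edges-inj : Injective _≡_ _≡_ edges
    joins : ∀ i → Joins G (edges i) (verts i) (verts (next i))
open Circuit public

edgeSet : ∀ {n m} {G : SignedGraph n m} → Circuit G → Subset m
edgeSet c = tabulate (λ e → does (any? (λ i → edges c i ≟ e)))

IsFlow : ∀ {n m} {G : SignedGraph n m} → Circuit G → Set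
IsFlow {G = G} c =
  Σ (Fin (suc (len c))) λ i → negative G (edges c i) ≡ true ×
    (∀ j → negative G (edges c j) ≡ true → j ≡ i)

-- Clutters on ground set Fin m, given as families of subsets.

Family : ℕ → Set₁
Family m = Subset m → Set

FlowClutter : ∀ {n m} → SignedGraph n m → Family m
FlowClutter G S = Σ (Circuit G) λ c → IsFlow c × edgeSet c ≡ S

sumFin : ∀ {m} → (Fin m → ℚ) → ℚ
sumFin {zero}  x = 0ℚ
sumFin {suc m} x = x zero + sumFin (x ∘ suc)

sumOver : ∀ {m} → Subset m → (Fin m → ℚ) → ℚ
sumOver S x = sumFin (λ e → if ⌊ e ∈? S ⌋ then x e else 0ℚ)

InCoveringPolyhedron : ∀ {m} → Family m → (Fin m → ℚ) → Set
InCoveringPolyhedron 𝒞 x =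
  (∀ e → 0ℚ ≤ x e) × (∀ S → 𝒞 S → 1ℚ ≤ sumOver S x)

IsVertex : ∀ {m} → Family m → (Fin m → ℚ) → Set
IsVertex 𝒞 x =
  InCoveringPolyhedron 𝒞 x ×
  (∀ y z (t : ℚ) → InCoveringPolyhedron 𝒞 y → InCoveringPolyhedron 𝒞 z →
     0ℚ < t → t < 1ℚ → (∀ e → x e ≡ t * y e + (1ℚ - t) * z e) →
     ∀ e → y e ≡ z e)

IsIntegral : ℚ → Set
IsIntegral q = Σ ℤ λ k → q ≡ k / 1

Ideal : ∀ {m} → Family m → Set
Ideal 𝒞 = ∀ x → IsVertex 𝒞 x → ∀ e → IsIntegral (x e)

delete : ∀ {n m} → SignedGraph n (suc m) → Fin (suc m) → SignedGraph n m
delete G e = record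
  { ends     = ends G ∘ punchIn e
  ; negative = negative G ∘ punchIn e }

-- contract edge e = uv: identify v with u (v then stays as an isolated
-- vertex, which does not affect circuits), and remove e
contract : ∀ {n m} → SignedGraph n (suc m) → Fin (suc m) → SignedGraph n m
contract {n} G e = record
  { ends     = λ f → ρ (proj₁ (ends G (punchIn e f))) , ρ (proj₂ (ends G (punchIn e f)))
  ; negative = negative G ∘ punchIn e }
  where
  ρ : Fin n → Fin n
  ρ w = if ⌊ w ≟ proj₂ (ends G e) ⌋ then proj₁ (ends G e) else w

-- contracting e creates no new negative loop (= no new singleton flow)
NoNewNegLoop : ∀ {n m} → SignedGraph n (suc m) → Fin (suc m) → Set
NoNewNegLoop G e = ∀ f → negative G (punchIn e f) ≡ true →
  IsLoop (contract G e) f → IsLoop G (punchIn e f)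

data _≼_ {n : ℕ} : ∀ {m' m} → SignedGraph n m' → SignedGraph n m → Set where
  ≼-refl : ∀ {m} {G : SignedGraph n m} → G ≼ G
  ≼-del  : ∀ {m' m} {H : SignedGraph n m'} {G : SignedGraph n (suc m)}
           (e : Fin (suc m)) → H ≼ delete G e → H ≼ G
  ≼-con  : ∀ {m' m} {H : SignedGraph n m'} {G : SignedGraph n (suc m)}
           (e : Fin (suc m)) → negative G e ≡ false → NoNewNegLoop G e →
           H ≼ contract G e → H ≼ G

data _≺_ {n : ℕ} : ∀ {m' m} → SignedGraph n m' → SignedGraph n m → Set where
  ≺-del  : ∀ {m' m} {H : SignedGraph n m'} {G : SignedGraph n (suc m)}
           (e : Fin (suc m)) → H ≼ delete G e → H ≺ G
  ≺-con  : ∀ {m' m} {H : SignedGraph n m'} {G : SignedGraph n (suc m)}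
           (e : Fin (suc m)) → negative G e ≡ false → NoNewNegLoop G e →
           H ≼ contract G e → H ≺ G

WeaklyMNI : ∀ {n m} → SignedGraph n m → Set
WeaklyMNI {n} G = ¬ Ideal (FlowClutter G) ×
  (∀ {m'} (H : SignedGraph n m') → H ≺ G → Ideal (FlowClutter H))

-- Deleting an edge e of G, or contracting a positive one, changes the flow clutter up to supersets exactly as
-- deleting or contracting e changes a clutter: closed walks with a single negative edge map back and forth.
-- A vertex x of the covering polyhedron of the minor extends to a vertex of the original one by inserting a
-- single coordinate at e: 0 for a contraction, and for a deletion the least value making every flow through e
-- covered. Integrality of x therefore follows from idealness of the larger clutter, so idealness is closed
-- under strong minors. Conversely, a non-ideal strong minor of G with the fewest edges is weakly MNI. The
-- case distinction "ideal or not" is constructively justified because integrality of a rational is decidable.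

module Submission where

open import Defs
open import Data.Bool using (true; false; if_then_else_)
open import Data.Empty using (⊥; ⊥-elim)
open import Data.Fin using (Fin; zero; suc; toℕ; fromℕ; inject₁; punchIn; punchOut; _≟_)
open import Data.Fin.Properties
  using (toℕ-fromℕ; toℕ-fromℕ<; toℕ-inject₁; toℕ-injective; toℕ<n; suc-injective; any?;
         punchIn-punchOut; punchIn-injective; punchInᵢ≢i)
open import Data.Fin.Subset using (Subset; _∈_; _∉_)
open import Data.Fin.Subset.Properties using (_∈?_)
import Data.Integer as ℤ
import Data.Integer.Properties as ℤ
open import Data.Integer.GCD using (gcd; gcd-zeroʳ)
open import Data.Nat as ℕ using (ℕ; zero; suc)
import Data.Nat.Properties as ℕ
open import Data.Nat.Induction using (<-rec)
open import Data.Product using (Σ; ∃; _×_; _,_; proj₁; proj₂)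
open import Data.Rational
  using (ℚ; 0ℚ; 1ℚ; _+_; _*_; _-_; -_; _≤_; _<_; _/_; ↥_; _⊔_; Positive; NonNegative; positive; nonNegative)
open import Data.Rational.Properties hiding (_≟_)
import Data.Rational.Properties as ℚ using (_≟_)
open import Data.Rational.Solver using (module +-*-Solver)
open import Data.Sum using (_⊎_; inj₁; inj₂)
open import Data.Unit using (⊤; tt)
open import Data.Vec using ([]; _∷_)
open import Data.Vec.Functional using (insertAt)
open import Data.Vec.Functional.Properties using (insertAt-lookup; insertAt-punchIn)
open import Data.Vec.Properties using (lookup∘tabulate; []=⇒lookup; lookup⇒[]=)
open import Function using (_∘_)
open import Function.Bundles using (_⇔_; mk⇔)
open import Relation.Binary.PropositionalEquality
open import Relation.Nullary using (¬_; Dec; yes; no; does)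
open import Relation.Nullary.Decidable using (⌊_⌋; decidable-stable; ¬¬-excluded-middle; dec-true)
open import Relation.Nullary.Negation using (¬¬-map)

open +-*-Solver

p-r≤q⇒p≤q+r : ∀ {p q r} → p - r ≤ q → p ≤ q + r
p-r≤q⇒p≤q+r {p} {q} {r} h = begin
  p          ≡⟨ solve 2 (λ p r → p := p :- r :+ r) refl p r ⟩
  p - r + r  ≤⟨ +-monoˡ-≤ r h ⟩
  q + r      ∎
  where open ≤-Reasoning

p≤q+r⇒p-r≤q : ∀ {p q r} → p ≤ q + r → p - r ≤ q
p≤q+r⇒p-r≤q {p} {q} {r} h = begin
  p - r      ≤⟨ +-monoˡ-≤ (- r) h ⟩
  q + r - r  ≡⟨ solve 2 (λ q r → q :+ r :- r := q) refl q r ⟩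
  q          ∎
  where open ≤-Reasoning

p≤q⇒0≤q-p : ∀ {p q} → p ≤ q → 0ℚ ≤ q - p
p≤q⇒0≤q-p {p} {q} h = subst (_≤ q - p) (+-inverseʳ p) (+-monoˡ-≤ (- p) h)

convex-tightˡ : ∀ {t a b v} → 0ℚ < t → t < 1ℚ → v ≤ a → v ≤ b →
                v ≡ t * a + (1ℚ - t) * b → a ≡ v
convex-tightˡ {t} {a} {b} {v} 0<t t<1 v≤a v≤b v≡ = ≤-antisym (*-cancelˡ-≤-pos t ta≤tv) v≤a
  where
  instance
    t-pos : Positive t
    t-pos = positive 0<t
    1-t-nonNeg : NonNegative (1ℚ - t)
    1-t-nonNeg = nonNegative (p≤q⇒0≤q-p (<⇒≤ t<1))
  ta≤tv : t * a ≤ t * v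
  ta≤tv = begin
    t * a                                    ≡⟨ solve 3 (λ t a v → t :* a := t :* a :+ (con 1ℚ :- t) :* v :- (con 1ℚ :- t) :* v)
                                                        refl t a v ⟩
    t * a + (1ℚ - t) * v - (1ℚ - t) * v      ≤⟨ +-monoˡ-≤ _ (+-monoʳ-≤ (t * a) (*-monoˡ-≤-nonNeg (1ℚ - t) v≤b)) ⟩
    t * a + (1ℚ - t) * b - (1ℚ - t) * v      ≡⟨ cong (_- (1ℚ - t) * v) (sym v≡) ⟩
    v - (1ℚ - t) * v                          ≡⟨ solve 2 (λ t v → v :- (con 1ℚ :- t) :* v := t :* v) refl t v ⟩
    t * v                                    ∎
    where open ≤-Reasoning

convex-tight : ∀ {t a b v} → 0ℚ < t → t < 1ℚ → v ≤ a → v ≤ b →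
               v ≡ t * a + (1ℚ - t) * b → a ≡ v × b ≡ v
convex-tight {t} {a} {b} {v} 0<t t<1 v≤a v≤b v≡ =
  convex-tightˡ 0<t t<1 v≤a v≤b v≡ ,
  convex-tightˡ 0<1-t 1-t<1 v≤b v≤a (trans v≡ (solve 3 swap refl t a b))
  where
  swap = λ t a b → t :* a :+ (con 1ℚ :- t) :* b := (con 1ℚ :- t) :* b :+ (con 1ℚ :- (con 1ℚ :- t)) :* a
  0<1-t : 0ℚ < 1ℚ - t
  0<1-t = subst (_< 1ℚ - t) (+-inverseʳ t) (+-monoˡ-< (- t) t<1)
  1-t<1 : 1ℚ - t < 1ℚ
  1-t<1 = subst (1ℚ - t <_) (+-identityʳ 1ℚ) (+-monoʳ-< 1ℚ (neg-antimono-< 0<t))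

convex-idem : ∀ t a → t * a + (1ℚ - t) * a ≡ a
convex-idem = solve 2 (λ t a → t :* a :+ (con 1ℚ :- t) :* a := a) refl

isIntegral? : (q : ℚ) → Dec (IsIntegral q)
isIntegral? q with q ℚ.≟ (↥ q / 1)
... | yes q≡ = yes (↥ q , q≡)
... | no q≢ = no λ (k , q≡k) → q≢ (trans q≡k (cong (_/ 1) (sym (trans (cong ↥_ q≡k) (↥k/1≡k k)))))
  where
  ↥k/1≡k : ∀ k → ↥ (k / 1) ≡ k
  ↥k/1≡k k = begin
    ↥ (k / 1)                         ≡⟨ sym (ℤ.*-identityʳ _) ⟩
    ↥ (k / 1) ℤ.* ℤ.+ 1               ≡⟨ cong (↥ (k / 1) ℤ.*_) (sym (gcd-zeroʳ k)) ⟩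
    ↥ (k / 1) ℤ.* gcd k (ℤ.+ 1)       ≡⟨ ↥-/ k 1 ⟩
    k                                 ∎
    where open ≡-Reasoning

sumFin-cong : ∀ {m} {x y : Fin m → ℚ} → (∀ i → x i ≡ y i) → sumFin x ≡ sumFin y
sumFin-cong {zero}  x≡y = refl
sumFin-cong {suc m} x≡y = cong₂ _+_ (x≡y zero) (sumFin-cong (x≡y ∘ suc))

sumFin-mono : ∀ {m} {x y : Fin m → ℚ} → (∀ i → x i ≤ y i) → sumFin x ≤ sumFin y
sumFin-mono {zero}  x≤y = ≤-refl
sumFin-mono {suc m} x≤y = +-mono-≤ (x≤y zero) (sumFin-mono (x≤y ∘ suc))

sumFin-punchIn : ∀ {m} (e : Fin (suc m)) (x : Fin (suc m) → ℚ) →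
                 sumFin x ≡ x e + sumFin (x ∘ punchIn e)
sumFin-punchIn zero x = refl
sumFin-punchIn {suc m} (suc e) x = begin
  x zero + sumFin (x ∘ suc)                                   ≡⟨ cong (x zero +_) (sumFin-punchIn e (x ∘ suc)) ⟩
  x zero + (x (suc e) + sumFin (x ∘ suc ∘ punchIn e))         ≡⟨ +-exchange (x zero) (x (suc e)) _ ⟩
  x (suc e) + (x zero + sumFin (x ∘ suc ∘ punchIn e))         ∎
  where
  open ≡-Reasoning
  +-exchange : ∀ a b c → a + (b + c) ≡ b + (a + c)
  +-exchange = solve 3 (λ a b c → a :+ (b :+ c) := b :+ (a :+ c)) refl

punchIn-cases : ∀ {m} (e i : Fin (suc m)) → i ≡ e ⊎ ∃ λ f → punchIn e f ≡ i
punchIn-cases e i with i ≟ e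
... | yes i≡e = inj₁ i≡e
... | no  i≢e = inj₂ (punchOut (i≢e ∘ sym) , punchIn-punchOut (i≢e ∘ sym))

≡-by-punchIn : ∀ {m} {A : Set} (e : Fin (suc m)) {y z : Fin (suc m) → A} →
               y e ≡ z e → (∀ f → y (punchIn e f) ≡ z (punchIn e f)) → ∀ i → y i ≡ z i
≡-by-punchIn e ye≡ze y≡z i with punchIn-cases e i
... | inj₁ refl       = ye≡ze
... | inj₂ (f , refl) = y≡z f

AllNonNeg : ∀ {m} → (Fin m → ℚ) → Set
AllNonNeg x = ∀ i → 0ℚ ≤ x i

-- Subsets of Fin m are compared with subsets of Fin (suc m) ∖ {e} via the bijection punchIn e.
_⊆⟨_⟩_ : ∀ {m} → Subset m → Fin (suc m) → Subset (suc m) → Set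
D ⊆⟨ e ⟩ S = ∀ {f} → f ∈ D → punchIn e f ∈ S

_⊇⟨_⟩_ : ∀ {m} → Subset m → Fin (suc m) → Subset (suc m) → Set
D ⊇⟨ e ⟩ S = ∀ {f} → punchIn e f ∈ S → f ∈ D

masked : ∀ {m} → Subset m → Fin m → ℚ → ℚ
masked S i a = if ⌊ i ∈? S ⌋ then a else 0ℚ

liftedSum : ∀ {m} → Fin (suc m) → Subset (suc m) → (Fin m → ℚ) → ℚ
liftedSum e S x = sumFin (λ f → masked S (punchIn e f) (x f))

masked-≤ : ∀ {m} S (i : Fin m) {a} → 0ℚ ≤ a → masked S i a ≤ a
masked-≤ S i 0≤a with i ∈? S
... | yes _ = ≤-refl
... | no  _ = 0≤a

masked-∉ : ∀ {m} S {i : Fin m} a → i ∉ S → masked S i a ≡ 0ℚ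
masked-∉ S {i} a i∉S with i ∈? S
... | yes i∈S = ⊥-elim (i∉S i∈S)
... | no  _   = refl

masked-0 : ∀ {m} S (i : Fin m) → masked S i 0ℚ ≡ 0ℚ
masked-0 S i with i ∈? S
... | yes _ = refl
... | no  _ = refl

liftedSum-cong : ∀ {m} (e : Fin (suc m)) S {x y : Fin m → ℚ} →
                 (∀ f → x f ≡ y f) → liftedSum e S x ≡ liftedSum e S y
liftedSum-cong e S x≡y = sumFin-cong λ f → cong (masked S (punchIn e f)) (x≡y f)

sumOver-punchIn : ∀ {m} (e : Fin (suc m)) S (y : Fin (suc m) → ℚ) →
                  sumOver S y ≡ masked S e (y e) + liftedSum e S (y ∘ punchIn e)
sumOver-punchIn e S y = sumFin-punchIn e (λ i → masked S i (y i))

sumOver-insertAt : ∀ {m} (e : Fin (suc m)) S (x : Fin m → ℚ) a →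
                   sumOver S (insertAt x e a) ≡ masked S e a + liftedSum e S x
sumOver-insertAt e S x a = trans (sumOver-punchIn e S (insertAt x e a))
  (cong₂ _+_ (cong (masked S e) (insertAt-lookup x e a)) (liftedSum-cong e S (insertAt-punchIn x e a)))

sumOver≤liftedSum : ∀ {m} {e : Fin (suc m)} {S D} {x : Fin m → ℚ} →
                    AllNonNeg x → D ⊆⟨ e ⟩ S → sumOver D x ≤ liftedSum e S x
sumOver≤liftedSum {e = e} {S} {D} {x} x≥0 D⊆S = sumFin-mono termwise
  where
  termwise : ∀ f → masked D f (x f) ≤ masked S (punchIn e f) (x f)
  termwise f with f ∈? D | punchIn e f ∈? S
  ... | yes _   | yes _   = ≤-refl
  ... | yes f∈D | no  f∉S = ⊥-elim (f∉S (D⊆S f∈D))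
  ... | no  _   | yes _   = x≥0 f
  ... | no  _   | no  _   = ≤-refl

liftedSum≤sumOver : ∀ {m} {e : Fin (suc m)} {S D} {x : Fin m → ℚ} →
                    AllNonNeg x → D ⊇⟨ e ⟩ S → liftedSum e S x ≤ sumOver D x
liftedSum≤sumOver {e = e} {S} {D} {x} x≥0 D⊇S = sumFin-mono termwise
  where
  termwise : ∀ f → masked S (punchIn e f) (x f) ≤ masked D f (x f)
  termwise f with f ∈? D | punchIn e f ∈? S
  ... | yes _   | yes _   = ≤-refl
  ... | no  f∉D | yes f∈S = ⊥-elim (f∉D (D⊇S f∈S))
  ... | yes _   | no  _   = x≥0 f
  ... | no  _   | no  _   = ≤-refl

maxSubset : ∀ {m} → (Subset m → ℚ) → ℚ
maxSubset {zero}  g = 0ℚ ⊔ g []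
maxSubset {suc m} g = maxSubset (g ∘ (true ∷_)) ⊔ maxSubset (g ∘ (false ∷_))

≤-maxSubset : ∀ {m} (g : Subset m → ℚ) S → g S ≤ maxSubset g
≤-maxSubset g []          = p≤q⊔p 0ℚ (g [])
≤-maxSubset g (true ∷ S)  = ≤-trans (≤-maxSubset (g ∘ (true ∷_)) S) (p≤p⊔q _ _)
≤-maxSubset g (false ∷ S) = ≤-trans (≤-maxSubset (g ∘ (false ∷_)) S) (p≤q⊔p (maxSubset (g ∘ (true ∷_))) _)

0≤maxSubset : ∀ {m} (g : Subset m → ℚ) → 0ℚ ≤ maxSubset g
0≤maxSubset {zero}  g = p≤p⊔q 0ℚ (g [])
0≤maxSubset {suc m} g = ≤-trans (0≤maxSubset (g ∘ (true ∷_))) (p≤p⊔q _ _)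

maxSubset-least : ∀ {m} (g : Subset m → ℚ) {b} → 0ℚ ≤ b → (∀ S → g S ≤ b) → maxSubset g ≤ b
maxSubset-least {zero}  g 0≤b g≤b = ⊔-lub 0≤b (g≤b [])
maxSubset-least {suc m} g 0≤b g≤b =
  ⊔-lub (maxSubset-least _ 0≤b (g≤b ∘ (true ∷_))) (maxSubset-least _ 0≤b (g≤b ∘ (false ∷_)))

¬¬-decidable : ∀ m (P : Subset m → Set) → ¬ ¬ (∀ S → Dec (P S))
¬¬-decidable zero P = ¬¬-map (λ { P? [] → P? }) ¬¬-excluded-middle
¬¬-decidable (suc m) P ¬P? =
  ¬¬-decidable m (P ∘ (true ∷_)) λ P₁? →
  ¬¬-decidable m (P ∘ (false ∷_)) λ P₀? →
  ¬P? λ { (true ∷ S) → P₁? S ; (false ∷ S) → P₀? S }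

Ideal-stable : ∀ {m} (𝒞 : Family m) → ¬ ¬ Ideal 𝒞 → Ideal 𝒞
Ideal-stable 𝒞 ¬¬ideal x x-vertex i =
  decidable-stable (isIntegral? (x i)) (¬¬-map (λ ideal → ideal x x-vertex i) ¬¬ideal)

IsExtreme : ∀ {m} → Family m → (Fin m → ℚ) → Set
IsExtreme 𝒞 x = ∀ y z (t : ℚ) → InCoveringPolyhedron 𝒞 y → InCoveringPolyhedron 𝒞 z →
  0ℚ < t → t < 1ℚ → (∀ e → x e ≡ t * y e + (1ℚ - t) * z e) → ∀ e → y e ≡ z e

-- 𝒟 agrees with 𝒞/e (resp. 𝒞∖e) up to taking supersets, which is all a covering polyhedron sees.
record IsContraction {m} (e : Fin (suc m)) (𝒞 : Family (suc m)) (𝒟 : Family m) : Set where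
  field
    shrink : ∀ {S} → 𝒞 S → ∃ λ D → 𝒟 D × D ⊆⟨ e ⟩ S
    grow   : ∀ {D} → 𝒟 D → ∃ λ C → 𝒞 C × D ⊇⟨ e ⟩ C

record IsDeletion {m} (e : Fin (suc m)) (𝒞 : Family (suc m)) (𝒟 : Family m) : Set where
  field
    shrink : ∀ {S} → 𝒞 S → e ∉ S → ∃ λ D → 𝒟 D × D ⊆⟨ e ⟩ S
    grow   : ∀ {D} → 𝒟 D → ∃ λ C → 𝒞 C × e ∉ C × D ⊇⟨ e ⟩ C

module _ {m} {e : Fin (suc m)} {𝒞 : Family (suc m)} {𝒟 : Family m} where

  ∈P-restrict : ∀ {y} → InCoveringPolyhedron 𝒞 y →
                (∀ {D} → 𝒟 D → ∃ λ C → 𝒞 C × masked C e (y e) ≡ 0ℚ × D ⊇⟨ e ⟩ C) →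
                InCoveringPolyhedron 𝒟 (y ∘ punchIn e)
  ∈P-restrict {y} (y≥0 , y-covers) grow = y≥0 ∘ punchIn e , covers
    where
    covers : ∀ D → 𝒟 D → 1ℚ ≤ sumOver D (y ∘ punchIn e)
    covers D D∈𝒟 with grow D∈𝒟
    ... | C , C∈𝒞 , ye-masked , D⊇C = begin
      1ℚ                                                 ≤⟨ y-covers C C∈𝒞 ⟩
      sumOver C y                                        ≡⟨ sumOver-punchIn e C y ⟩
      masked C e (y e) + liftedSum e C (y ∘ punchIn e)   ≡⟨ cong (_+ liftedSum e C (y ∘ punchIn e)) ye-masked ⟩
      0ℚ + liftedSum e C (y ∘ punchIn e)                 ≡⟨ +-identityˡ _ ⟩
      liftedSum e C (y ∘ punchIn e)                      ≤⟨ liftedSum≤sumOver (y≥0 ∘ punchIn e) D⊇C ⟩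
      sumOver D (y ∘ punchIn e)                          ∎
      where open ≤-Reasoning

  covered-by-shrink : ∀ {x S D} → InCoveringPolyhedron 𝒟 x → 𝒟 D → D ⊆⟨ e ⟩ S → 1ℚ ≤ liftedSum e S x
  covered-by-shrink (x≥0 , x-covers) D∈𝒟 D⊆S = ≤-trans (x-covers _ D∈𝒟) (sumOver≤liftedSum x≥0 D⊆S)

  ∈P-insertAt : ∀ {x a} → AllNonNeg x → 0ℚ ≤ a →
                (∀ S → 𝒞 S → 1ℚ ≤ masked S e a + liftedSum e S x) →
                InCoveringPolyhedron 𝒞 (insertAt x e a)
  ∈P-insertAt {x} {a} x≥0 0≤a covers = nonNeg , λ S S∈𝒞 →
    subst (1ℚ ≤_) (sym (sumOver-insertAt e S x a)) (covers S S∈𝒞)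
    where
    nonNeg : AllNonNeg (insertAt x e a)
    nonNeg i with punchIn-cases e i
    ... | inj₁ refl       = subst (0ℚ ≤_) (sym (insertAt-lookup x e a)) 0≤a
    ... | inj₂ (f , refl) = subst (0ℚ ≤_) (sym (insertAt-punchIn x e a f)) (x≥0 f)

  Ideal-fromVertexExtension : Ideal 𝒞 →
    (∀ x → IsVertex 𝒟 x → Σ ℚ λ a → IsVertex 𝒞 (insertAt x e a)) → Ideal 𝒟
  Ideal-fromVertexExtension 𝒞-ideal extend x x-vertex f with extend x x-vertex
  ... | a , x′-vertex = subst IsIntegral (insertAt-punchIn x e a f) (𝒞-ideal _ x′-vertex (punchIn e f))

  module _ (contraction : IsContraction e 𝒞 𝒟) where
    open IsContraction contraction

    insertAt-0-isVertex : ∀ {x} → IsVertex 𝒟 x → IsVertex 𝒞 (insertAt x e 0ℚ)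
    insertAt-0-isVertex {x} (x∈P@(x≥0 , _) , x-extreme) = x′∈P , extreme
      where
      x′∈P : InCoveringPolyhedron 𝒞 (insertAt x e 0ℚ)
      x′∈P = ∈P-insertAt x≥0 ≤-refl λ S S∈𝒞 →
        let D , D∈𝒟 , D⊆S = shrink S∈𝒞 in
        subst (1ℚ ≤_) (sym (trans (cong (_+ liftedSum e S x) (masked-0 S e)) (+-identityˡ _)))
          (covered-by-shrink x∈P D∈𝒟 D⊆S)
      restrict : ∀ {w} → InCoveringPolyhedron 𝒞 w → w e ≡ 0ℚ → InCoveringPolyhedron 𝒟 (w ∘ punchIn e)
      restrict w∈P we≡0 = ∈P-restrict w∈P λ D∈𝒟 →
        let C , C∈𝒞 , D⊇C = grow D∈𝒟 in C , C∈𝒞 , trans (cong (masked C e) we≡0) (masked-0 C e) , D⊇C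
      extreme : IsExtreme 𝒞 (insertAt x e 0ℚ)
      extreme y z t y∈P@(y≥0 , _) z∈P@(z≥0 , _) 0<t t<1 x′≡ =
        ≡-by-punchIn e (trans ye≡0 (sym ze≡0))
          (x-extreme _ _ t (restrict y∈P ye≡0) (restrict z∈P ze≡0) 0<t t<1 λ f →
            trans (sym (insertAt-punchIn x e 0ℚ f)) (x′≡ (punchIn e f)))
        where
        tight = convex-tight 0<t t<1 (y≥0 e) (z≥0 e) (trans (sym (insertAt-lookup x e 0ℚ)) (x′≡ e))
        ye≡0 = proj₁ tight
        ze≡0 = proj₂ tight

  Ideal-contraction : IsContraction e 𝒞 𝒟 → Ideal 𝒞 → Ideal 𝒟
  Ideal-contraction contraction 𝒞-ideal =
    Ideal-fromVertexExtension 𝒞-ideal λ x x-vertex → 0ℚ , insertAt-0-isVertex contraction x-vertex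

  module _ (deletion : IsDeletion e 𝒞 𝒟) (𝒞? : ∀ S → Dec (𝒞 S)) where
    open IsDeletion deletion

    deficit : (Fin m → ℚ) → Subset (suc m) → ℚ
    deficit x S = if ⌊ 𝒞? S ⌋ then 1ℚ - liftedSum e S x else 0ℚ

    -- The least non-negative value at e for which insertAt x e _ covers every member of 𝒞.
    deletionHeight : (Fin m → ℚ) → ℚ
    deletionHeight x = maxSubset (deficit x)

    deficit-∈ : ∀ {x S} → 𝒞 S → deficit x S ≡ 1ℚ - liftedSum e S x
    deficit-∈ {S = S} S∈𝒞 with 𝒞? S
    ... | yes _   = refl
    ... | no  S∉𝒞 = ⊥-elim (S∉𝒞 S∈𝒞)

    deletionHeight-least : ∀ {x y} → InCoveringPolyhedron 𝒞 y → (∀ f → y (punchIn e f) ≡ x f) →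
                           deletionHeight x ≤ y e
    deletionHeight-least {x} {y} (y≥0 , y-covers) y≡x = maxSubset-least (deficit x) (y≥0 e) bound
      where
      bound : ∀ S → deficit x S ≤ y e
      bound S with 𝒞? S
      ... | no  _   = y≥0 e
      ... | yes S∈𝒞 = p≤q+r⇒p-r≤q (begin
        1ℚ                                                ≤⟨ y-covers S S∈𝒞 ⟩
        sumOver S y                                       ≡⟨ sumOver-punchIn e S y ⟩
        masked S e (y e) + liftedSum e S (y ∘ punchIn e)  ≤⟨ +-monoˡ-≤ _ (masked-≤ S e (y≥0 e)) ⟩
        y e + liftedSum e S (y ∘ punchIn e)               ≡⟨ cong (y e +_) (liftedSum-cong e S y≡x) ⟩
        y e + liftedSum e S x                             ∎)
        where open ≤-Reasoning

    insertAt-height-isVertex : ∀ {x} → IsVertex 𝒟 x → IsVertex 𝒞 (insertAt x e (deletionHeight x))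
    insertAt-height-isVertex {x} (x∈P@(x≥0 , _) , x-extreme) = x′∈P , extreme
      where
      h = deletionHeight x
      covers : ∀ S → 𝒞 S → 1ℚ ≤ masked S e h + liftedSum e S x
      covers S S∈𝒞 with e ∈? S
      ... | yes _   = p-r≤q⇒p≤q+r (subst (_≤ h) (deficit-∈ S∈𝒞) (≤-maxSubset (deficit x) S))
      ... | no  e∉S = let D , D∈𝒟 , D⊆S = shrink S∈𝒞 e∉S in
                      subst (1ℚ ≤_) (sym (+-identityˡ _)) (covered-by-shrink x∈P D∈𝒟 D⊆S)
      x′∈P : InCoveringPolyhedron 𝒞 (insertAt x e h)
      x′∈P = ∈P-insertAt x≥0 (0≤maxSubset (deficit x)) covers
      restrict : ∀ {w} → InCoveringPolyhedron 𝒞 w → InCoveringPolyhedron 𝒟 (w ∘ punchIn e)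
      restrict {w} w∈P = ∈P-restrict w∈P λ D∈𝒟 →
        let C , C∈𝒞 , e∉C , D⊇C = grow D∈𝒟 in C , C∈𝒞 , masked-∉ C (w e) e∉C , D⊇C
      extreme : IsExtreme 𝒞 (insertAt x e h)
      extreme y z t y∈P z∈P 0<t t<1 x′≡ = ≡-by-punchIn e (trans ye≡h (sym ze≡h)) y≡z
        where
        x≡ : ∀ f → x f ≡ t * y (punchIn e f) + (1ℚ - t) * z (punchIn e f)
        x≡ f = trans (sym (insertAt-punchIn x e h f)) (x′≡ (punchIn e f))
        y≡z : ∀ f → y (punchIn e f) ≡ z (punchIn e f)
        y≡z = x-extreme _ _ t (restrict y∈P) (restrict z∈P) 0<t t<1 x≡
        y≡x : ∀ f → y (punchIn e f) ≡ x f
        y≡x f = sym (trans (x≡ f) (trans (cong (λ w → t * y (punchIn e f) + (1ℚ - t) * w) (sym (y≡z f)))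
                                          (convex-idem t (y (punchIn e f)))))
        tight = convex-tight 0<t t<1
          (deletionHeight-least y∈P y≡x)
          (deletionHeight-least z∈P λ f → trans (sym (y≡z f)) (y≡x f))
          (trans (sym (insertAt-lookup x e h)) (x′≡ e))
        ye≡h = proj₁ tight
        ze≡h = proj₂ tight

  -- Membership in 𝒞 is decidable only in the ¬¬-sense, which suffices as idealness is stable.
  Ideal-deletion : IsDeletion e 𝒞 𝒟 → Ideal 𝒞 → Ideal 𝒟
  Ideal-deletion deletion 𝒞-ideal = Ideal-stable 𝒟 λ ¬𝒟-ideal → ¬¬-decidable (suc m) 𝒞 λ 𝒞? →
    ¬𝒟-ideal (Ideal-fromVertexExtension 𝒞-ideal λ x x-vertex →
      _ , insertAt-height-isVertex deletion 𝒞? x-vertex)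

next-fromℕ : ∀ k → next (fromℕ k) ≡ zero
next-fromℕ k with suc (toℕ (fromℕ k)) ℕ.<? suc k
... | yes k<k = ⊥-elim (ℕ.<-irrefl refl (subst (λ i → suc i ℕ.< suc k) (toℕ-fromℕ k) k<k))
... | no  _   = refl

next-inject₁ : ∀ {k} (i : Fin k) → next (inject₁ i) ≡ suc i
next-inject₁ {k} i with suc (toℕ (inject₁ i)) ℕ.<? suc k
... | yes i<k = toℕ-injective (trans (toℕ-fromℕ< i<k) (cong suc (toℕ-inject₁ i)))
... | no  i≮k = ⊥-elim (i≮k (ℕ.s≤s (subst (ℕ._< k) (sym (toℕ-inject₁ i)) (toℕ<n i))))

fromℕ-or-inject₁ : ∀ {k} (i : Fin (suc k)) → i ≡ fromℕ k ⊎ ∃ λ j → i ≡ inject₁ j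
fromℕ-or-inject₁ {zero}  zero    = inj₁ refl
fromℕ-or-inject₁ {suc k} zero    = inj₂ (zero , refl)
fromℕ-or-inject₁ {suc k} (suc i) with fromℕ-or-inject₁ i
... | inj₁ i≡k       = inj₁ (cong suc i≡k)
... | inj₂ (j , i≡j) = inj₂ (suc j , cong suc i≡j)

module _ {n m} {G : SignedGraph n m} where

  joins-end : ∀ {g a b x y} → Joins G g a b → Joins G g x y → a ≡ x ⊎ a ≡ y
  joins-end (inj₁ (p , _)) (inj₁ (q , _)) = inj₁ (trans (sym p) q)
  joins-end (inj₁ (p , _)) (inj₂ (q , _)) = inj₂ (trans (sym p) q)
  joins-end (inj₂ (_ , p)) (inj₁ (_ , q)) = inj₂ (trans (sym p) q)
  joins-end (inj₂ (_ , p)) (inj₂ (_ , q)) = inj₁ (trans (sym p) q)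

  data Walk : Fin n → Fin n → Set where
    nil  : ∀ {x} → Walk x x
    cons : ∀ {x y z} (g : Fin m) → Joins G g x y → Walk y z → Walk x z

  _∈ᵉ_ : ∀ {x y} → Fin m → Walk x y → Set
  g ∈ᵉ nil          = ⊥
  g ∈ᵉ cons h _ W   = g ≡ h ⊎ g ∈ᵉ W

  _∈ᵛ_ : ∀ {x y} → Fin n → Walk x y → Set
  _∈ᵛ_ {x} v nil          = v ≡ x
  _∈ᵛ_ {x} v (cons _ _ W) = v ≡ x ⊎ v ∈ᵛ W

  _∈ᵛ?_ : ∀ {x y} v (W : Walk x y) → Dec (v ∈ᵛ W)
  _∈ᵛ?_ {x} v nil          = v ≟ x
  _∈ᵛ?_ {x} v (cons _ _ W) with v ≟ x | v ∈ᵛ? W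
  ... | yes v≡x | _       = yes (inj₁ v≡x)
  ... | no  _   | yes v∈W = yes (inj₂ v∈W)
  ... | no  v≢x | no  v∉W = no λ { (inj₁ v≡x) → v≢x v≡x ; (inj₂ v∈W) → v∉W v∈W }

  start-∈ᵛ : ∀ {x y} (W : Walk x y) → x ∈ᵛ W
  start-∈ᵛ nil          = refl
  start-∈ᵛ (cons _ _ _) = inj₁ refl

  ends-∈ᵛ : ∀ {x y g a b} (W : Walk x y) → g ∈ᵉ W → Joins G g a b → a ∈ᵛ W
  ends-∈ᵛ (cons g j W) (inj₁ refl) j′ with joins-end j′ j
  ... | inj₁ a≡x = inj₁ a≡x
  ... | inj₂ a≡y = inj₂ (subst (_∈ᵛ W) (sym a≡y) (start-∈ᵛ W))
  ends-∈ᵛ (cons h j W) (inj₂ g∈W) j′ = inj₂ (ends-∈ᵛ W g∈W j′)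

  _++_ : ∀ {x y z} → Walk x y → Walk y z → Walk x z
  nil          ++ W = W
  cons g j V   ++ W = cons g j (V ++ W)

  ∈ᵉ-++⁻ : ∀ {x y z g} (V : Walk x y) (W : Walk y z) → g ∈ᵉ (V ++ W) → g ∈ᵉ V ⊎ g ∈ᵉ W
  ∈ᵉ-++⁻ nil          W g∈W           = inj₂ g∈W
  ∈ᵉ-++⁻ (cons h j V) W (inj₁ g≡h)    = inj₁ (inj₁ g≡h)
  ∈ᵉ-++⁻ (cons h j V) W (inj₂ g∈V++W) with ∈ᵉ-++⁻ V W g∈V++W
  ... | inj₁ g∈V = inj₁ (inj₂ g∈V)
  ... | inj₂ g∈W = inj₂ g∈W

  AllPositive : ∀ {x y} → Walk x y → Set
  AllPositive W = ∀ {g} → g ∈ᵉ W → negative G g ≡ false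

  negatives : ∀ {x y} → Walk x y → ℕ
  negatives nil          = zero
  negatives (cons g _ W) = if negative G g then suc (negatives W) else negatives W

  negatives≡0⇒allPositive : ∀ {x y} (W : Walk x y) → negatives W ≡ 0 → AllPositive W
  negatives≡0⇒allPositive (cons g _ W) none g′∈W with negative G g in g-sign
  negatives≡0⇒allPositive (cons g _ W) () _ | true
  negatives≡0⇒allPositive (cons g _ W) none (inj₁ refl) | false = g-sign
  negatives≡0⇒allPositive (cons g _ W) none (inj₂ g′∈W) | false = negatives≡0⇒allPositive W none g′∈W

  allPositive⇒negatives≡0 : ∀ {x y} (W : Walk x y) → AllPositive W → negatives W ≡ 0
  allPositive⇒negatives≡0 nil          _   = refl
  allPositive⇒negatives≡0 (cons g _ W) pos rewrite pos (inj₁ refl) = allPositive⇒negatives≡0 W (pos ∘ inj₂)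

  negatives-++ : ∀ {x y z} (V : Walk x y) (W : Walk y z) → negatives (V ++ W) ≡ negatives V ℕ.+ negatives W
  negatives-++ nil          W = refl
  negatives-++ (cons g _ V) W with negative G g
  ... | true  = cong suc (negatives-++ V W)
  ... | false = negatives-++ V W

  _⊆ᵉ_ : ∀ {x y x′ y′} → Walk x y → Walk x′ y′ → Set
  V ⊆ᵉ W = ∀ {g} → g ∈ᵉ V → g ∈ᵉ W

  record NegativeSplit {x y} (W : Walk x y) : Set where
    field
      {a b}           : Fin n
      f               : Fin m
      f-joins         : Joins G f a b
      f-negative      : negative G f ≡ true
      f∈W             : f ∈ᵉ W
      before          : Walk x a
      after           : Walk b y
      before-positive : AllPositive before
      after-positive  : AllPositive after
      before⊆W        : before ⊆ᵉ W
      after⊆W         : after ⊆ᵉ W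

  splitAtNegative : ∀ {x y} (W : Walk x y) → negatives W ≡ 1 → NegativeSplit W
  splitAtNegative (cons g j W) one with negative G g in g-sign
  ... | true = record
    { f = g ; f-joins = j ; f-negative = g-sign ; f∈W = inj₁ refl
    ; before = nil ; after = W
    ; before-positive = λ () ; after-positive = negatives≡0⇒allPositive W (ℕ.suc-injective one)
    ; before⊆W = λ () ; after⊆W = inj₂ }
  ... | false = record
    { f = f ; f-joins = f-joins ; f-negative = f-negative ; f∈W = inj₂ f∈W
    ; before = cons g j before ; after = after
    ; before-positive = λ { (inj₁ refl) → g-sign ; (inj₂ g′∈) → before-positive g′∈ }
    ; after-positive = after-positive
    ; before⊆W = λ { (inj₁ g′≡g) → inj₁ g′≡g ; (inj₂ g′∈) → inj₂ (before⊆W g′∈) }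
    ; after⊆W = inj₂ ∘ after⊆W }
    where open NegativeSplit (splitAtNegative W one)

  IsPath : ∀ {x y} → Walk x y → Set
  IsPath nil                  = ⊤
  IsPath (cons {x} _ _ W)     = ¬ x ∈ᵛ W × IsPath W

  suffixFrom : ∀ {x y v} (W : Walk x y) → v ∈ᵛ W →
               Σ (Walk v y) λ Q → (IsPath W → IsPath Q) × Q ⊆ᵉ W
  suffixFrom nil          refl        = nil , (λ _ → tt) , λ ()
  suffixFrom (cons g j W) (inj₁ refl) = cons g j W , (λ p → p) , (λ g∈ → g∈)
  suffixFrom (cons g j W) (inj₂ v∈W)  with suffixFrom W v∈W
  ... | Q , path , Q⊆W = Q , path ∘ proj₂ , inj₂ ∘ Q⊆W

  toPath : ∀ {x y} (W : Walk x y) → Σ (Walk x y) λ P → IsPath P × P ⊆ᵉ W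
  toPath nil = nil , tt , λ ()
  toPath (cons {x} g j W) with toPath W
  ... | P , P-path , P⊆W with x ∈ᵛ? P
  ...   | yes x∈P = let Q , Q-path , Q⊆P = suffixFrom P x∈P in Q , Q-path P-path , inj₂ ∘ P⊆W ∘ Q⊆P
  ...   | no  x∉P = cons g j P , (x∉P , P-path) ,
                    λ { (inj₁ g′≡g) → inj₁ g′≡g ; (inj₂ g′∈) → inj₂ (P⊆W g′∈) }

  length : ∀ {x y} → Walk x y → ℕ
  length nil          = zero
  length (cons _ _ W) = suc (length W)

  vertexAt : ∀ {x y} (W : Walk x y) → Fin (suc (length W)) → Fin n
  vertexAt {x} nil            zero    = x
  vertexAt (cons {x} _ _ _)   zero    = x
  vertexAt (cons _ _ W)       (suc i) = vertexAt W i

  -- Positions along W continued by one closing edge to z: the vertex after position i and the edge at i.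
  vertexAfter : ∀ {x y} (W : Walk x y) → Fin n → Fin (suc (length W)) → Fin n
  vertexAfter nil          z zero    = z
  vertexAfter (cons _ _ W) z zero    = vertexAt W zero
  vertexAfter (cons _ _ W) z (suc i) = vertexAfter W z i

  edgeAt : ∀ {x y} (W : Walk x y) → Fin m → Fin (suc (length W)) → Fin m
  edgeAt nil          f zero    = f
  edgeAt (cons g _ W) f zero    = g
  edgeAt (cons _ _ W) f (suc i) = edgeAt W f i

  vertexAt-zero : ∀ {x y} (W : Walk x y) → vertexAt W zero ≡ x
  vertexAt-zero nil          = refl
  vertexAt-zero (cons _ _ _) = refl

  vertexAt-∈ᵛ : ∀ {x y} (W : Walk x y) i → vertexAt W i ∈ᵛ W
  vertexAt-∈ᵛ nil          zero    = refl
  vertexAt-∈ᵛ (cons _ _ W) zero    = inj₁ refl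
  vertexAt-∈ᵛ (cons _ _ W) (suc i) = inj₂ (vertexAt-∈ᵛ W i)

  vertexAt-injective : ∀ {x y} (W : Walk x y) → IsPath W → ∀ {i j} → vertexAt W i ≡ vertexAt W j → i ≡ j
  vertexAt-injective nil          _           {zero}  {zero}  _  = refl
  vertexAt-injective (cons _ _ W) _           {zero}  {zero}  _  = refl
  vertexAt-injective (cons _ _ W) (x∉W , _)   {zero}  {suc j} eq = ⊥-elim (x∉W (subst (_∈ᵛ W) (sym eq) (vertexAt-∈ᵛ W j)))
  vertexAt-injective (cons _ _ W) (x∉W , _)   {suc i} {zero}  eq = ⊥-elim (x∉W (subst (_∈ᵛ W) eq (vertexAt-∈ᵛ W i)))
  vertexAt-injective (cons _ _ W) (_ , path)  {suc i} {suc j} eq = cong suc (vertexAt-injective W path eq)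

  vertexAfter-inject₁ : ∀ {x y} (W : Walk x y) z (i : Fin (length W)) → vertexAfter W z (inject₁ i) ≡ vertexAt W (suc i)
  vertexAfter-inject₁ (cons _ _ W) z zero    = refl
  vertexAfter-inject₁ (cons _ _ W) z (suc i) = vertexAfter-inject₁ W z i

  vertexAfter-fromℕ : ∀ {x y} (W : Walk x y) z → vertexAfter W z (fromℕ (length W)) ≡ z
  vertexAfter-fromℕ nil          z = refl
  vertexAfter-fromℕ (cons _ _ W) z = vertexAfter-fromℕ W z

  vertexAfter-start : ∀ {x y} (W : Walk x y) i → vertexAfter W x i ≡ vertexAt W (next i)
  vertexAfter-start {x} W i with fromℕ-or-inject₁ i
  ... | inj₁ refl = begin
    vertexAfter W x (fromℕ (length W))   ≡⟨ vertexAfter-fromℕ W x ⟩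
    x                                    ≡⟨ vertexAt-zero W ⟨
    vertexAt W zero                      ≡⟨ cong (vertexAt W) (next-fromℕ (length W)) ⟨
    vertexAt W (next (fromℕ (length W))) ∎
    where open ≡-Reasoning
  ... | inj₂ (j , refl) = trans (vertexAfter-inject₁ W x j) (cong (vertexAt W) (sym (next-inject₁ j)))

  joins-edgeAt : ∀ {x y z} (W : Walk x y) f → Joins G f y z →
                 ∀ i → Joins G (edgeAt W f i) (vertexAt W i) (vertexAfter W z i)
  joins-edgeAt nil              f f-joins zero    = f-joins
  joins-edgeAt (cons {x} g j W) f f-joins zero    = subst (Joins G g x) (sym (vertexAt-zero W)) j
  joins-edgeAt (cons _ _ W)     f f-joins (suc i) = joins-edgeAt W f f-joins i

  edgeAt-∈ : ∀ {x y} (W : Walk x y) f i → edgeAt W f i ≡ f ⊎ edgeAt W f i ∈ᵉ W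
  edgeAt-∈ nil          f zero    = inj₁ refl
  edgeAt-∈ (cons _ _ W) f zero    = inj₂ (inj₁ refl)
  edgeAt-∈ (cons _ _ W) f (suc i) with edgeAt-∈ W f i
  ... | inj₁ ≡f = inj₁ ≡f
  ... | inj₂ ∈W = inj₂ (inj₂ ∈W)

  edgeAt-fromℕ : ∀ {x y} (W : Walk x y) f → edgeAt W f (fromℕ (length W)) ≡ f
  edgeAt-fromℕ nil          f = refl
  edgeAt-fromℕ (cons _ _ W) f = edgeAt-fromℕ W f

  -- An edge of a path has both ends on it, so it cannot reappear after the first vertex.
  edgeAt-injective : ∀ {x y} (W : Walk x y) f → IsPath W → ¬ f ∈ᵉ W →
                     ∀ {i j} → edgeAt W f i ≡ edgeAt W f j → i ≡ j
  edgeAt-injective nil          f _ _ {zero} {zero} _ = refl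
  edgeAt-injective (cons _ _ W) f _ _ {zero} {zero} _ = refl
  edgeAt-injective (cons g j W) f (x∉W , _) f∉ {zero} {suc k} eq with edgeAt-∈ W f k
  ... | inj₁ ≡f = ⊥-elim (f∉ (inj₁ (trans (sym ≡f) (sym eq))))
  ... | inj₂ ∈W = ⊥-elim (x∉W (ends-∈ᵛ W (subst (_∈ᵉ W) (sym eq) ∈W) j))
  edgeAt-injective (cons g j W) f (x∉W , _) f∉ {suc k} {zero} eq with edgeAt-∈ W f k
  ... | inj₁ ≡f = ⊥-elim (f∉ (inj₁ (trans (sym ≡f) eq)))
  ... | inj₂ ∈W = ⊥-elim (x∉W (ends-∈ᵛ W (subst (_∈ᵉ W) eq ∈W) j))
  edgeAt-injective (cons _ _ W) f (_ , path) f∉ {suc i} {suc k} eq = cong suc (edgeAt-injective W f path (f∉ ∘ inj₂) eq)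

  closePath : ∀ {a b f} (P : Walk b a) → IsPath P → Joins G f a b → ¬ f ∈ᵉ P → Circuit G
  closePath {f = f} P path f-joins f∉P = record
    { len       = length P
    ; verts     = vertexAt P
    ; edges     = edgeAt P f
    ; verts-inj = vertexAt-injective P path
    ; edges-inj = edgeAt-injective P f path f∉P
    ; joins     = λ i → subst (Joins G (edgeAt P f i) (vertexAt P i)) (vertexAfter-start P i) (joins-edgeAt P f f-joins i) }

  closePath-isFlow : ∀ {a b f} (P : Walk b a) (path : IsPath P) (f-joins : Joins G f a b) (f∉P : ¬ f ∈ᵉ P) →
                     AllPositive P → negative G f ≡ true → IsFlow (closePath P path f-joins f∉P)
  closePath-isFlow {f = f} P path _ f∉P P-positive f-negative =
    fromℕ (length P) , trans (cong (negative G) (edgeAt-fromℕ P f)) f-negative , only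
    where
    only : ∀ i → negative G (edgeAt P f i) ≡ true → i ≡ fromℕ (length P)
    only i negative-i with edgeAt-∈ P f i
    ... | inj₁ ≡f = edgeAt-injective P f path f∉P (trans ≡f (sym (edgeAt-fromℕ P f)))
    ... | inj₂ ∈P with trans (sym (P-positive ∈P)) negative-i
    ...   | ()

  edgeSet-∈⁻ : ∀ (c : Circuit G) {g} → g ∈ edgeSet c → ∃ λ i → edges c i ≡ g
  edgeSet-∈⁻ c {g} g∈c =
    does-true⇒ (any? λ i → edges c i ≟ g) (trans (sym (lookup∘tabulate _ g)) ([]=⇒lookup g∈c))
    where
    does-true⇒ : ∀ {A : Set} (a? : Dec A) → does a? ≡ true → A
    does-true⇒ (yes a) _ = a

  edgeSet-∈⁺ : ∀ (c : Circuit G) i → edges c i ∈ edgeSet c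
  edgeSet-∈⁺ c i = lookup⇒[]= (edges c i) (edgeSet c)
    (trans (lookup∘tabulate _ (edges c i)) (dec-true (any? λ j → edges c j ≟ edges c i) (i , refl)))

  -- Rotating W to start just after its negative edge f leaves a positive walk from the head of f back
  -- to its tail; its underlying path, closed up by f, is a flow.
  closedWalk⇒flow : ∀ {x} (W : Walk x x) → negatives W ≡ 1 →
                    ∃ λ D → FlowClutter G D × (∀ {g} → g ∈ D → g ∈ᵉ W)
  closedWalk⇒flow W one = edgeSet c , (c , closePath-isFlow P P-path f-joins f∉P P-positive f-negative , refl) , c⊆W
    where
    open NegativeSplit (splitAtNegative W one)
    rotated = after ++ before
    rotated⊆W : rotated ⊆ᵉ W
    rotated⊆W g∈ with ∈ᵉ-++⁻ after before g∈
    ... | inj₁ g∈after  = after⊆W g∈after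
    ... | inj₂ g∈before = before⊆W g∈before
    rotated-positive : AllPositive rotated
    rotated-positive g∈ with ∈ᵉ-++⁻ after before g∈
    ... | inj₁ g∈after  = after-positive g∈after
    ... | inj₂ g∈before = before-positive g∈before
    P = proj₁ (toPath rotated)
    P-path = proj₁ (proj₂ (toPath rotated))
    P⊆rotated = proj₂ (proj₂ (toPath rotated))
    P-positive : AllPositive P
    P-positive = rotated-positive ∘ P⊆rotated
    f∉P : ¬ f ∈ᵉ P
    f∉P f∈P with trans (sym (P-positive f∈P)) f-negative
    ... | ()
    c = closePath P P-path f-joins f∉P
    c⊆W : ∀ {g} → g ∈ edgeSet c → g ∈ᵉ W
    c⊆W g∈c with edgeSet-∈⁻ c g∈c
    ... | i , refl with edgeAt-∈ P f i
    ...   | inj₁ ≡f = subst (_∈ᵉ W) (sym ≡f) f∈W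
    ...   | inj₂ ∈P = rotated⊆W (P⊆rotated ∈P)

  indexWalk : ∀ k (vs : Fin (suc k) → Fin n) (es : Fin k → Fin m) {z} → vs (fromℕ k) ≡ z →
              (∀ i → Joins G (es i) (vs (inject₁ i)) (vs (suc i))) → Walk (vs zero) z
  indexWalk zero    vs es refl steps = nil
  indexWalk (suc k) vs es end  steps = cons (es zero) (steps zero) (indexWalk k (vs ∘ suc) (es ∘ suc) end (steps ∘ suc))

  ∈ᵉ-indexWalk : ∀ k vs es {z} (end : vs (fromℕ k) ≡ z) steps {g} →
                 g ∈ᵉ indexWalk k vs es end steps → ∃ λ i → es i ≡ g
  ∈ᵉ-indexWalk zero    vs es refl steps ()
  ∈ᵉ-indexWalk (suc k) vs es end  steps (inj₁ g≡) = zero , sym g≡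
  ∈ᵉ-indexWalk (suc k) vs es end  steps (inj₂ g∈) with ∈ᵉ-indexWalk k (vs ∘ suc) (es ∘ suc) end (steps ∘ suc) g∈
  ... | i , es-i≡g = suc i , es-i≡g

  negatives-indexWalk : ∀ k vs es {z} (end : vs (fromℕ k) ≡ z) steps i →
                        negative G (es i) ≡ true → (∀ j → negative G (es j) ≡ true → j ≡ i) →
                        negatives (indexWalk k vs es end steps) ≡ 1
  negatives-indexWalk (suc k) vs es end steps zero negative-i only with negative G (es zero)
  ... | true  = cong suc (allPositive⇒negatives≡0 _ rest-positive)
    where
    rest-positive : AllPositive (indexWalk k (vs ∘ suc) (es ∘ suc) end (steps ∘ suc))
    rest-positive g∈ with ∈ᵉ-indexWalk k (vs ∘ suc) (es ∘ suc) end (steps ∘ suc) g∈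
    ... | j , refl with negative G (es (suc j)) in negative-j
    ...   | false = refl
    ...   | true with only (suc j) negative-j
    ...     | ()
  negatives-indexWalk (suc k) vs es end steps (suc i) negative-i only with negative G (es zero) in negative-0
  ... | true with only zero negative-0
  ...   | ()
  negatives-indexWalk (suc k) vs es end steps (suc i) negative-i only | false =
    negatives-indexWalk k (vs ∘ suc) (es ∘ suc) end (steps ∘ suc) i negative-i
      λ j negative-j → suc-injective (only (suc j) negative-j)

  flow⇒closedWalk : ∀ {S} → FlowClutter G S →
                    Σ (Fin n) λ x → Σ (Walk x x) λ W → negatives W ≡ 1 × (∀ {g} → g ∈ᵉ W → g ∈ S)
  flow⇒closedWalk (c , (i , negative-i , only) , refl) =
    verts c zero , W , negatives-indexWalk k vs (edges c) end steps i negative-i only ,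
    λ g∈W → let j , edge-j≡g = ∈ᵉ-indexWalk k vs (edges c) end steps g∈W in
            subst (_∈ edgeSet c) edge-j≡g (edgeSet-∈⁺ c j)
    where
    k = suc (len c)
    vs : Fin (suc k) → Fin n
    vs zero    = verts c zero
    vs (suc j) = verts c (next j)
    end : vs (fromℕ k) ≡ verts c zero
    end = cong (verts c) (next-fromℕ (len c))
    steps : ∀ j → Joins G (edges c j) (vs (inject₁ j)) (vs (suc j))
    steps zero    = joins c zero
    steps (suc j) = subst (λ v → Joins G (edges c (suc j)) v (verts c (next (suc j))))
                          (cong (verts c) (sym (next-inject₁ j))) (joins c (suc j))
    W = indexWalk k vs (edges c) end steps

module _ {n m} {G : SignedGraph n (suc m)} {e : Fin (suc m)} where

  undelete : ∀ {x y} → Walk {G = delete G e} x y → Walk {G = G} x y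
  undelete nil          = nil
  undelete (cons f j W) = cons (punchIn e f) j (undelete W)

  negatives-undelete : ∀ {x y} (W : Walk x y) → negatives (undelete W) ≡ negatives W
  negatives-undelete nil          = refl
  negatives-undelete (cons f _ W) = cong (λ k → if negative G (punchIn e f) then suc k else k) (negatives-undelete W)

  ∈ᵉ-undelete⁺ : ∀ {x y f} (W : Walk x y) → f ∈ᵉ W → punchIn e f ∈ᵉ undelete W
  ∈ᵉ-undelete⁺ (cons f _ W) (inj₁ refl) = inj₁ refl
  ∈ᵉ-undelete⁺ (cons _ _ W) (inj₂ f∈W)  = inj₂ (∈ᵉ-undelete⁺ W f∈W)

  ∈ᵉ-undelete⁻ : ∀ {x y g} (W : Walk x y) → g ∈ᵉ undelete W → ∃ λ f → punchIn e f ≡ g × f ∈ᵉ W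
  ∈ᵉ-undelete⁻ (cons f _ W) (inj₁ refl) = f , refl , inj₁ refl
  ∈ᵉ-undelete⁻ (cons _ _ W) (inj₂ g∈W)  with ∈ᵉ-undelete⁻ W g∈W
  ... | f , refl , f∈W = f , refl , inj₂ f∈W

  deleteWalk : ∀ {x y} (W : Walk {G = G} x y) → ¬ e ∈ᵉ W →
               Σ (Walk {G = delete G e} x y) λ W′ → undelete W′ ≡ W
  deleteWalk nil          _   = nil , refl
  deleteWalk (cons g j W) e∉W with punchIn-cases e g
  ... | inj₁ refl       = ⊥-elim (e∉W (inj₁ refl))
  ... | inj₂ (f , refl) with deleteWalk W (e∉W ∘ inj₂)
  ...   | W′ , refl = cons f j W′ , refl

  delete-isDeletion : IsDeletion e (FlowClutter G) (FlowClutter (delete G e))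
  delete-isDeletion = record { shrink = shrink ; grow = grow }
    where
    shrink : ∀ {S} → FlowClutter G S → ¬ e ∈ S → ∃ λ D → FlowClutter (delete G e) D × D ⊆⟨ e ⟩ S
    shrink S-flow e∉S with flow⇒closedWalk S-flow
    ... | _ , W , one , W⊆S with deleteWalk W (e∉S ∘ W⊆S)
    ...   | W′ , refl with closedWalk⇒flow W′ (trans (sym (negatives-undelete W′)) one)
    ...     | D , D-flow , D⊆W′ = D , D-flow , W⊆S ∘ ∈ᵉ-undelete⁺ W′ ∘ D⊆W′
    grow : ∀ {D} → FlowClutter (delete G e) D → ∃ λ C → FlowClutter G C × ¬ e ∈ C × D ⊇⟨ e ⟩ C
    grow {D} D-flow with flow⇒closedWalk D-flow
    ... | _ , W′ , one , W′⊆D with closedWalk⇒flow (undelete W′) (trans (negatives-undelete W′) one)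
    ...   | C , C-flow , C⊆W = C , C-flow , e∉C , D⊇C
      where
      e∉C : ¬ e ∈ C
      e∉C e∈C with ∈ᵉ-undelete⁻ W′ (C⊆W e∈C)
      ... | f , f↦e , _ = punchInᵢ≢i e f f↦e
      D⊇C : D ⊇⟨ e ⟩ C
      D⊇C {f} f∈C with ∈ᵉ-undelete⁻ W′ (C⊆W f∈C)
      ... | f′ , f′↦f , f′∈W′ = W′⊆D (subst (_∈ᵉ W′) (punchIn-injective e f′ f f′↦f) f′∈W′)

module _ {n m} {G : SignedGraph n (suc m)} {e : Fin (suc m)} where
  private
    G′ = contract G e
    u = proj₁ (ends G e)
    v = proj₂ (ends G e)

  merge : Fin n → Fin n
  merge w = if ⌊ w ≟ v ⌋ then u else w

  merge-v : merge v ≡ u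
  merge-v with v ≟ v
  ... | yes _   = refl
  ... | no  v≢v = ⊥-elim (v≢v refl)

  merge-≢v : ∀ {w} → w ≢ v → merge w ≡ w
  merge-≢v {w} w≢v with w ≟ v
  ... | yes w≡v = ⊥-elim (w≢v w≡v)
  ... | no  _   = refl

  merge-u : merge u ≡ u
  merge-u with u ≟ v
  ... | yes _ = refl
  ... | no  _ = refl

  merge-joins-e : ∀ {x y} → Joins G e x y → merge x ≡ merge y
  merge-joins-e (inj₁ (refl , refl)) = trans merge-u (sym merge-v)
  merge-joins-e (inj₂ (refl , refl)) = trans merge-v (sym merge-u)

  joins-merge : ∀ {f x y} → Joins G (punchIn e f) x y → Joins G′ f (merge x) (merge y)
  joins-merge (inj₁ (p , q)) = inj₁ (cong merge p , cong merge q)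
  joins-merge (inj₂ (p , q)) = inj₂ (cong merge p , cong merge q)

  joins-unmerge : ∀ {f p q} → Joins G′ f p q →
                  ∃ λ a → ∃ λ b → Joins G (punchIn e f) a b × merge a ≡ p × merge b ≡ q
  joins-unmerge (inj₁ (p , q)) = _ , _ , inj₁ (refl , refl) , p , q
  joins-unmerge (inj₂ (p , q)) = _ , _ , inj₂ (refl , refl) , q , p

  module _ (e-positive : negative G e ≡ false) where

    contractWalk : ∀ {x y p q} (W : Walk {G = G} x y) → merge x ≡ p → merge y ≡ q →
                   Σ (Walk {G = G′} p q) λ W′ →
                     negatives W′ ≡ negatives W × (∀ {f} → f ∈ᵉ W′ → punchIn e f ∈ᵉ W)
    contractWalk nil          refl refl = nil , refl , λ ()
    contractWalk (cons g j W) x↦p y↦q with punchIn-cases e g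
    ... | inj₁ refl with contractWalk W (trans (sym (merge-joins-e j)) x↦p) y↦q
    ...   | W′ , same-negatives , W′⊆W rewrite e-positive = W′ , same-negatives , inj₂ ∘ W′⊆W
    contractWalk (cons g j W) refl y↦q | inj₂ (f , refl) with contractWalk W refl y↦q
    ... | W′ , same-negatives , W′⊆W =
      cons f (joins-merge j) W′ ,
      cong (λ k → if negative G (punchIn e f) then suc k else k) same-negatives ,
      λ { (inj₁ refl) → inj₁ refl ; (inj₂ f′∈W′) → inj₂ (W′⊆W f′∈W′) }

    WalkAlong-e : Fin n → Fin n → Set
    WalkAlong-e x y = Σ (Walk {G = G} x y) λ C → negatives C ≡ 0 × (∀ {g} → g ∈ᵉ C → g ≡ e)

    connect : ∀ x y → merge x ≡ merge y → WalkAlong-e x y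
    connect x y x≈y = by-cases (x ≟ v) (y ≟ v)
      where
      along-e : Joins G e x y → WalkAlong-e x y
      along-e j = cons e j nil ,
                  allPositive⇒negatives≡0 {G = G} (cons e j nil) (λ { (inj₁ refl) → e-positive }) ,
                  λ { (inj₁ g≡e) → g≡e }
      by-cases : Dec (x ≡ v) → Dec (y ≡ v) → WalkAlong-e x y
      by-cases (yes refl) (yes refl) = nil , refl , λ ()
      by-cases (yes refl) (no y≢v) = along-e (inj₂ (trans (sym merge-v) (trans x≈y (merge-≢v y≢v)) , refl))
      by-cases (no x≢v) (yes refl) = along-e (inj₁ (sym (trans (sym (merge-≢v x≢v)) (trans x≈y merge-v)) , refl))
      by-cases (no x≢v) (no y≢v) with trans (sym (merge-≢v x≢v)) (trans x≈y (merge-≢v y≢v))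
      ... | refl = nil , refl , λ ()

    uncontractWalk : ∀ {p q x y} (W′ : Walk {G = G′} p q) → merge x ≡ p → merge y ≡ q →
                     Σ (Walk {G = G} x y) λ W → negatives W ≡ negatives W′ ×
                       (∀ {g} → g ∈ᵉ W → g ≡ e ⊎ ∃ λ f → punchIn e f ≡ g × f ∈ᵉ W′)
    uncontractWalk {x = x} {y} nil x↦p y↦q with connect x y (trans x↦p (sym y↦q))
    ... | C , C-positive , C⊆e = C , C-positive , inj₁ ∘ C⊆e
    uncontractWalk {x = x} {y} (cons f j W′) x↦p y↦q with joins-unmerge j
    ... | a , b , j-ab , a↦ , b↦ with connect x a (trans x↦p (sym a↦)) | uncontractWalk W′ b↦ y↦q
    ...   | C , C-positive , C⊆e | W , same-negatives , W⊆W′ =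
      C ++ cons (punchIn e f) j-ab W , negatives≡ , ⊆W′
      where
      negatives≡ : negatives (C ++ cons (punchIn e f) j-ab W) ≡ negatives (cons f j W′)
      negatives≡ = trans (negatives-++ C _)
        (trans (cong (ℕ._+ negatives (cons (punchIn e f) j-ab W)) C-positive)
               (cong (λ k → if negative G (punchIn e f) then suc k else k) same-negatives))
      ⊆W′ : ∀ {g} → g ∈ᵉ (C ++ cons (punchIn e f) j-ab W) →
            g ≡ e ⊎ ∃ λ f′ → punchIn e f′ ≡ g × f′ ∈ᵉ cons f j W′
      ⊆W′ g∈ with ∈ᵉ-++⁻ C _ g∈
      ... | inj₁ g∈C        = inj₁ (C⊆e g∈C)
      ... | inj₂ (inj₁ refl) = inj₂ (f , refl , inj₁ refl)
      ... | inj₂ (inj₂ g∈W) with W⊆W′ g∈W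
      ...   | inj₁ g≡e            = inj₁ g≡e
      ...   | inj₂ (f′ , f′↦g , f′∈W′) = inj₂ (f′ , f′↦g , inj₂ f′∈W′)

    contract-isContraction : IsContraction e (FlowClutter G) (FlowClutter G′)
    contract-isContraction = record { shrink = shrink ; grow = grow }
      where
      shrink : ∀ {S} → FlowClutter G S → ∃ λ D → FlowClutter G′ D × D ⊆⟨ e ⟩ S
      shrink S-flow with flow⇒closedWalk S-flow
      ... | _ , W , one , W⊆S with contractWalk W refl refl
      ...   | W′ , same-negatives , W′⊆W with closedWalk⇒flow W′ (trans same-negatives one)
      ...     | D , D-flow , D⊆W′ = D , D-flow , W⊆S ∘ W′⊆W ∘ D⊆W′
      grow : ∀ {D} → FlowClutter G′ D → ∃ λ C → FlowClutter G C × D ⊇⟨ e ⟩ C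
      grow {D} D-flow with flow⇒closedWalk D-flow
      ... | p , W′@(cons _ j _) , one , W′⊆D with joins-unmerge j
      ...   | a , _ , _ , a↦p , _ with uncontractWalk {x = a} {y = a} W′ a↦p a↦p
      ...     | W , same-negatives , W⊆W′ with closedWalk⇒flow W (trans same-negatives one)
      ...       | C , C-flow , C⊆W = C , C-flow , D⊇C
        where
        D⊇C : D ⊇⟨ e ⟩ C
        D⊇C {f} f∈C with W⊆W′ (C⊆W f∈C)
        ... | inj₁ f↦e = ⊥-elim (punchInᵢ≢i e f f↦e)
        ... | inj₂ (f′ , f′↦f , f′∈W′) = W′⊆D (subst (_∈ᵉ W′) (punchIn-injective e f′ f f′↦f) f′∈W′)

private
  variable
    n m m′ m″ : ℕ
    G : SignedGraph n m
    H : SignedGraph n m′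
    K : SignedGraph n m″

-- Contraction preserves idealness even when it creates a negative loop.
Ideal-≼ : H ≼ G → Ideal (FlowClutter G) → Ideal (FlowClutter H)
Ideal-≼ ≼-refl                       = λ ideal → ideal
Ideal-≼ (≼-del e H≼G∖e)              = Ideal-≼ H≼G∖e ∘ Ideal-deletion delete-isDeletion
Ideal-≼ (≼-con e e-positive _ H≼G/e) = Ideal-≼ H≼G/e ∘ Ideal-contraction (contract-isContraction e-positive)

≼-trans : K ≼ H → H ≼ G → K ≼ G
≼-trans K≼H ≼-refl                     = K≼H
≼-trans K≼H (≼-del e H≼)               = ≼-del e (≼-trans K≼H H≼)
≼-trans K≼H (≼-con e e-pos no-loop H≼) = ≼-con e e-pos no-loop (≼-trans K≼H H≼)

≺⇒≼ : H ≺ G → H ≼ G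
≺⇒≼ (≺-del e H≼)               = ≼-del e H≼
≺⇒≼ (≺-con e e-pos no-loop H≼) = ≼-con e e-pos no-loop H≼

≼⇒≤ : {H : SignedGraph n m′} {G : SignedGraph n m} → H ≼ G → m′ ℕ.≤ m
≼⇒≤ ≼-refl            = ℕ.≤-refl
≼⇒≤ (≼-del e H≼)      = ℕ.m≤n⇒m≤1+n (≼⇒≤ H≼)
≼⇒≤ (≼-con e _ _ H≼)  = ℕ.m≤n⇒m≤1+n (≼⇒≤ H≼)

≺⇒< : {H : SignedGraph n m′} {G : SignedGraph n m} → H ≺ G → m′ ℕ.< m
≺⇒< (≺-del e H≼)     = ℕ.s≤s (≼⇒≤ H≼)
≺⇒< (≺-con e _ _ H≼) = ℕ.s≤s (≼⇒≤ H≼)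

HasWeaklyMNIMinor : SignedGraph n m → Set
HasWeaklyMNIMinor {n} G = Σ ℕ (λ m′ → Σ (SignedGraph n m′) (λ H → H ≼ G × WeaklyMNI H))

noWeaklyMNIMinor⇒Ideal : ∀ m (G : SignedGraph n m) → ¬ HasWeaklyMNIMinor G → Ideal (FlowClutter G)
noWeaklyMNIMinor⇒Ideal = <-rec _ λ m rec G no-minor → Ideal-stable _ λ ¬ideal →
  no-minor (m , G , ≼-refl , ¬ideal , λ H H≺G → rec (≺⇒< H≺G) H λ (_ , K , K≼H , K-mni) →
    no-minor (_ , K , ≼-trans K≼H (≺⇒≼ H≺G) , K-mni))

lemma1 : ∀ {n m} (G : SignedGraph n m) →
    Ideal (FlowClutter G) ⇔
      (¬ Σ ℕ (λ m' → Σ (SignedGraph n m') (λ H → H ≼ G × WeaklyMNI H)))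
lemma1 {m = m} G = mk⇔
  (λ ideal (_ , H , H≼G , H-nonideal , _) → H-nonideal (Ideal-≼ H≼G ideal))
  (noWeaklyMNIMinor⇒Ideal m G)
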